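{- Let $\Gamma_1$ and $\Gamma_2$ be graphs. Then each of the direct product $\Gamma_1\times\Gamma_2$, the cartesian product $\Gamma_1\boxtimes\Gamma_2$, and the normal product $\Gamma_1\ast\Gamma_2$ is a generalized product: for each of these three products there exist generalizations $W_1$ on $\Gamma_1$ and $W_2$ on $\Gamma_2$ such that the generalized product $\Gamma_1\,{}_{W_1}\!\times_{W_2}\Gamma_2$ equals that product (same vertex set $V(\Gamma_1)\times V(\Gamma_2)$ and same edge set).
   Context: Graphs are simple and undirected. $\mathbb{N}$ denotes the set of positive integers and $\mathbb{Z}^\sharp=\mathbb{N}\cup\{0\}$. For integers $a,d$, $AP(a,d)=\{a+kd : k\in\mathbb{Z}^\sharp\}$ is the arithmetic progression with initial term $a$ and common difference $d$ (so $AP(a,0)=\{a\}$). For a graph $\Gamma$, $A(\Gamma)$ is its arc set, i.e. the set of ordered pairs $(u,v)$ of adjacent vertices, and $\triangle=\{(v,v): v\in V(\Gamma)\}$. A generalization on $\Gamma$ is a function $W: A(\Gamma)\cup\triangle\to\mathbb{Z}^\sharp\times\mathbb{Z}^\sharp$. Given graphs $\Gamma_1,\Gamma_2$ with generalizations $W_1,W_2$, the generalized product $\Gamma_1\,{}_{W_1}\!\times_{W_2}\Gamma_2$ has vertex set $V(\Gamma_1)\times V(\Gamma_2)$, and $(g_1,g_2)\sim(g_1',g_2')$ if and only if (i) $(g_1,g_2)\neq(g_1',g_2')$ and (ii) $AP(W_1(g_1,g_1'))\cap AP(W_2(g_2,g_2'))\cap\mathbb{N}\neq\emptyset$ or $AP(W_1(g_1',g_1))\cap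 AP(W_2(g_2',g_2))\cap\mathbb{N}\neq\emptyset$ (each alternative in (ii) being understood to require that the pairs involved lie in the domains of $W_1$, $W_2$ respectively). Products of graphs, all on vertex set $V(\Gamma_1)\times V(\Gamma_2)$: direct product $\Gamma_1\times\Gamma_2$: $(g_1,g_2)\sim(g_1',g_2')$ iff $g_1\sim g_1'$ and $g_2\sim g_2'$; cartesian product $\Gamma_1\boxtimes\Gamma_2$: iff ($g_1=g_1'$ and $g_2\sim g_2'$) or ($g_1\sim g_1'$ and $g_2=g_2'$); normal product $\Gamma_1\ast\Gamma_2$: iff ($g_1\sim g_1'$ and $g_2\sim g_2'$) or ($g_1=g_1'$ and $g_2\sim g_2'$) or ($g_1\sim g_1'$ and $g_2=g_2'$). -}

module Defs where

open import Data.Nat using (ℕ; zero; suc; _+_; _*_)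
open import Data.Product using (Σ; ∃; _×_; _,_)
open import Data.Sum using (_⊎_)
open import Data.Bool using (Bool; true)
open import Relation.Binary.PropositionalEquality using (_≡_)
open import Relation.Nullary using (¬_)

record Graph : Set₁ where
  field
    V      : Set
    adj    : V → V → Bool
    sym    : ∀ u v → adj u v ≡ true → adj v u ≡ true
    irrefl : ∀ v → ¬ (adj v v ≡ true)

open Graph public

Adj : (Γ : Graph) → V Γ → V Γ → Set
Adj Γ u v = adj Γ u v ≡ true

InDom : (Γ : Graph) → V Γ → V Γ → Set
InDom Γ u v = (u ≡ v) ⊎ Adj Γ u v

-- It is given as a function on all pairs, but only
-- its values on A(Γ) ∪ △ are ever used (every function on A(Γ) ∪ △ extends
-- to all pairs), so existence statements are unaffected.
Generalization : Graph → Set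
Generalization Γ = V Γ → V Γ → ℕ × ℕ

_∈AP_ : ℕ → ℕ × ℕ → Set
n ∈AP (a , d) = ∃ λ (k : ℕ) → n ≡ a + k * d

-- AP(p) ∩ AP(q) ∩ ℕ ≠ ∅   (ℕ = positive integers)
APMeet : ℕ × ℕ → ℕ × ℕ → Set
APMeet p q = ∃ λ (m : ℕ) → (suc m ∈AP p) × (suc m ∈AP q)

PV : Graph → Graph → Set
PV Γ₁ Γ₂ = V Γ₁ × V Γ₂

GenProdAdj : (Γ₁ Γ₂ : Graph) → Generalization Γ₁ → Generalization Γ₂ →
             PV Γ₁ Γ₂ → PV Γ₁ Γ₂ → Set
GenProdAdj Γ₁ Γ₂ W₁ W₂ (g₁ , g₂) (g₁' , g₂') =
  ¬ ((g₁ , g₂) ≡ (g₁' , g₂')) ×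
  ( (InDom Γ₁ g₁ g₁' × InDom Γ₂ g₂ g₂' × APMeet (W₁ g₁ g₁') (W₂ g₂ g₂'))
  ⊎ (InDom Γ₁ g₁' g₁ × InDom Γ₂ g₂' g₂ × APMeet (W₁ g₁' g₁) (W₂ g₂' g₂)))

DirectAdj : (Γ₁ Γ₂ : Graph) → PV Γ₁ Γ₂ → PV Γ₁ Γ₂ → Set
DirectAdj Γ₁ Γ₂ (g₁ , g₂) (g₁' , g₂') = Adj Γ₁ g₁ g₁' × Adj Γ₂ g₂ g₂'

CartesianAdj : (Γ₁ Γ₂ : Graph) → PV Γ₁ Γ₂ → PV Γ₁ Γ₂ → Set
CartesianAdj Γ₁ Γ₂ (g₁ , g₂) (g₁' , g₂') =
  (g₁ ≡ g₁' × Adj Γ₂ g₂ g₂') ⊎ (Adj Γ₁ g₁ g₁' × g₂ ≡ g₂')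

NormalAdj : (Γ₁ Γ₂ : Graph) → PV Γ₁ Γ₂ → PV Γ₁ Γ₂ → Set
NormalAdj Γ₁ Γ₂ (g₁ , g₂) (g₁' , g₂') =
  (Adj Γ₁ g₁ g₁' × Adj Γ₂ g₂ g₂')
  ⊎ ((g₁ ≡ g₁' × Adj Γ₂ g₂ g₂') ⊎ (Adj Γ₁ g₁ g₁' × g₂ ≡ g₂'))

IsGeneralizedProduct : (Γ₁ Γ₂ : Graph) → (PV Γ₁ Γ₂ → PV Γ₁ Γ₂ → Set) → Set
IsGeneralizedProduct Γ₁ Γ₂ R =
  Σ (Generalization Γ₁) λ W₁ → Σ (Generalization Γ₂) λ W₂ →
    ∀ (x y : PV Γ₁ Γ₂) →
      (GenProdAdj Γ₁ Γ₂ W₁ W₂ x y → R x y) × (R x y → GenProdAdj Γ₁ Γ₂ W₁ W₂ x y)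

-- A generalization that only sees whether a pair of vertices is an arc or a
-- diagonal pair (f true on arcs, f false on △) turns the generalized product
-- into a "pattern product": (g₁, g₂) ~ (g₁', g₂') iff both coordinate pairs
-- lie in A ∪ △ and p(edge₁?, edge₂?) holds, provided AP(f₁ b) and AP(f₂ c)
-- meet in ℕ exactly when p b c, and p false false = false (no loops).  The
-- direct, cartesian and normal products are the patterns ∧, xor and ∨, each
-- realized by small progressions; e.g. for the normal product take AP(1,1),
-- AP(1,0) on Γ₁ and AP(1,1), AP(2,0) on Γ₂: only AP(1,0) and AP(2,0) are
-- disjoint.
module Submission where

open import Defs hiding (sym)
open import Data.Bool using (Bool; true; false; T; _∧_; _∨_; _xor_)
open import Data.Bool.Properties using (¬-not)
open import Data.Nat using (ℕ; _+_)
open import Data.Nat.Properties using (*-zeroʳ; +-identityʳ)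
open import Data.Product using (Σ; _×_; _,_)
open import Data.Sum using (inj₁; inj₂)
open import Data.Unit using (tt)
open import Function using (_∘_)
open import Function.Bundles using (_⇔_; mk⇔; Equivalence)
open import Relation.Nullary using (¬_)
open import Relation.Binary.PropositionalEquality
  using (_≡_; refl; sym; trans; subst; subst₂; cong)

open Equivalence using (to; from)

∈AP-const⇒≡ : ∀ {n a} → n ∈AP (a , 0) → n ≡ a
∈AP-const⇒≡ {a = a} (k , n≡a+k*0) = trans n≡a+k*0 (trans (cong (a +_) (*-zeroʳ k)) (+-identityʳ a))

APMeet-const⇒≡ : ∀ {a b} → APMeet (a , 0) (b , 0) → a ≡ b
APMeet-const⇒≡ (_ , m∈a , m∈b) = trans (sym (∈AP-const⇒≡ m∈a)) (∈AP-const⇒≡ m∈b)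

¬APMeet-zeroˡ : ∀ {q} → ¬ APMeet (0 , 0) q
¬APMeet-zeroˡ (_ , m∈0 , _) with ∈AP-const⇒≡ m∈0
... | ()

MeetPattern : (Bool → ℕ × ℕ) → (Bool → ℕ × ℕ) → (Bool → Bool → Bool) → Set
MeetPattern f₁ f₂ p = ∀ b c → APMeet (f₁ b) (f₂ c) ⇔ T (p b c)

byAdjacency : (Γ : Graph) → (Bool → ℕ × ℕ) → Generalization Γ
byAdjacency Γ f u v = f (adj Γ u v)

isEdge : (Γ : Graph) {u v : V Γ} → InDom Γ u v → Bool
isEdge Γ (inj₁ _) = false
isEdge Γ (inj₂ _) = true

adj-loop : (Γ : Graph) (v : V Γ) → adj Γ v v ≡ false
adj-loop Γ v = ¬-not (irrefl Γ v)

adj≡isEdge : (Γ : Graph) {u v : V Γ} (d : InDom Γ u v) → adj Γ u v ≡ isEdge Γ d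
adj≡isEdge Γ (inj₁ refl) = adj-loop Γ _
adj≡isEdge Γ (inj₂ u~v)  = u~v

isEdge-loop : (Γ : Graph) {v : V Γ} (d : InDom Γ v v) → isEdge Γ d ≡ false
isEdge-loop Γ d = trans (sym (adj≡isEdge Γ d)) (adj-loop Γ _)

InDom-sym : (Γ : Graph) {u v : V Γ} → InDom Γ u v → InDom Γ v u
InDom-sym Γ (inj₁ u≡v) = inj₁ (sym u≡v)
InDom-sym Γ (inj₂ u~v) = inj₂ (Graph.sym Γ _ _ u~v)

isEdge-InDom-sym : (Γ : Graph) {u v : V Γ} (d : InDom Γ u v) → isEdge Γ (InDom-sym Γ d) ≡ isEdge Γ d
isEdge-InDom-sym Γ (inj₁ _) = refl
isEdge-InDom-sym Γ (inj₂ _) = refl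

module _ (Γ₁ Γ₂ : Graph) where

  PatternProductAdj : (Bool → Bool → Bool) → PV Γ₁ Γ₂ → PV Γ₁ Γ₂ → Set
  PatternProductAdj p (g₁ , g₂) (g₁' , g₂') =
    Σ (InDom Γ₁ g₁ g₁') λ d₁ → Σ (InDom Γ₂ g₂ g₂') λ d₂ → T (p (isEdge Γ₁ d₁) (isEdge Γ₂ d₂))

  PatternProductAdj-sym : ∀ {p x y} → PatternProductAdj p x y → PatternProductAdj p y x
  PatternProductAdj-sym {p} (d₁ , d₂ , t) =
    InDom-sym Γ₁ d₁ , InDom-sym Γ₂ d₂ ,
    subst₂ (λ b c → T (p b c)) (sym (isEdge-InDom-sym Γ₁ d₁)) (sym (isEdge-InDom-sym Γ₂ d₂)) t

  PatternProductAdj-irrefl : ∀ {p x} → p false false ≡ false → ¬ PatternProductAdj p x x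
  PatternProductAdj-irrefl {p} pff≡false (d₁ , d₂ , t) =
    subst T pff≡false (subst₂ (λ b c → T (p b c)) (isEdge-loop Γ₁ d₁) (isEdge-loop Γ₂ d₂) t)

  module _ {f₁ f₂ : Bool → ℕ × ℕ} {p : Bool → Bool → Bool} (meets : MeetPattern f₁ f₂ p) where

    APMeet⇔pattern : ∀ {u u' v v'} (d₁ : InDom Γ₁ u u') (d₂ : InDom Γ₂ v v') →
      APMeet (f₁ (adj Γ₁ u u')) (f₂ (adj Γ₂ v v')) ⇔ T (p (isEdge Γ₁ d₁) (isEdge Γ₂ d₂))
    APMeet⇔pattern d₁ d₂ rewrite adj≡isEdge Γ₁ d₁ | adj≡isEdge Γ₂ d₂ = meets (isEdge Γ₁ d₁) (isEdge Γ₂ d₂)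

    genProd⇔patternProduct : p false false ≡ false → ∀ x y →
      GenProdAdj Γ₁ Γ₂ (byAdjacency Γ₁ f₁) (byAdjacency Γ₂ f₂) x y ⇔ PatternProductAdj p x y
    genProd⇔patternProduct pff≡false x y = mk⇔ genProd⇒pattern pattern⇒genProd
      where
      genProd⇒pattern : GenProdAdj Γ₁ Γ₂ (byAdjacency Γ₁ f₁) (byAdjacency Γ₂ f₂) x y →
                        PatternProductAdj p x y
      genProd⇒pattern (_ , inj₁ (d₁ , d₂ , meet)) = d₁ , d₂ , to (APMeet⇔pattern d₁ d₂) meet
      genProd⇒pattern (_ , inj₂ (d₁ , d₂ , meet)) =
        PatternProductAdj-sym {p} (d₁ , d₂ , to (APMeet⇔pattern d₁ d₂) meet)

      pattern⇒genProd : PatternProductAdj p x y →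
                        GenProdAdj Γ₁ Γ₂ (byAdjacency Γ₁ f₁) (byAdjacency Γ₂ f₂) x y
      pattern⇒genProd xy@(d₁ , d₂ , t) =
        (λ { refl → PatternProductAdj-irrefl {p} pff≡false xy }) ,
        inj₁ (d₁ , d₂ , from (APMeet⇔pattern d₁ d₂) t)

    isGeneralizedProduct : {R : PV Γ₁ Γ₂ → PV Γ₁ Γ₂ → Set} → p false false ≡ false →
      (∀ x y → R x y ⇔ PatternProductAdj p x y) → IsGeneralizedProduct Γ₁ Γ₂ R
    isGeneralizedProduct pff≡false R⇔pattern =
      byAdjacency Γ₁ f₁ , byAdjacency Γ₂ f₂ , λ x y →
        from (R⇔pattern x y) ∘ to (genProd⇔patternProduct pff≡false x y) ,
        from (genProd⇔patternProduct pff≡false x y) ∘ to (R⇔pattern x y)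

  direct⇔∧ : ∀ x y → DirectAdj Γ₁ Γ₂ x y ⇔ PatternProductAdj _∧_ x y
  direct⇔∧ x y = mk⇔
    (λ (a₁ , a₂) → inj₂ a₁ , inj₂ a₂ , tt)
    (λ { (inj₂ a₁ , inj₂ a₂ , _) → a₁ , a₂
       ; (inj₁ _  , _       , ()) ; (inj₂ _ , inj₁ _ , ()) })

  cartesian⇔xor : ∀ x y → CartesianAdj Γ₁ Γ₂ x y ⇔ PatternProductAdj _xor_ x y
  cartesian⇔xor x y = mk⇔
    (λ { (inj₁ (e₁ , a₂)) → inj₁ e₁ , inj₂ a₂ , tt
       ; (inj₂ (a₁ , e₂)) → inj₂ a₁ , inj₁ e₂ , tt })
    (λ { (inj₁ e₁ , inj₂ a₂ , _) → inj₁ (e₁ , a₂)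
       ; (inj₂ a₁ , inj₁ e₂ , _) → inj₂ (a₁ , e₂)
       ; (inj₁ _  , inj₁ _  , ()) ; (inj₂ _ , inj₂ _ , ()) })

  normal⇔∨ : ∀ x y → NormalAdj Γ₁ Γ₂ x y ⇔ PatternProductAdj _∨_ x y
  normal⇔∨ x y = mk⇔
    (λ { (inj₁ (a₁ , a₂))        → inj₂ a₁ , inj₂ a₂ , tt
       ; (inj₂ (inj₁ (e₁ , a₂))) → inj₁ e₁ , inj₂ a₂ , tt
       ; (inj₂ (inj₂ (a₁ , e₂))) → inj₂ a₁ , inj₁ e₂ , tt })
    (λ { (inj₂ a₁ , inj₂ a₂ , _) → inj₁ (a₁ , a₂)
       ; (inj₁ e₁ , inj₂ a₂ , _) → inj₂ (inj₁ (e₁ , a₂))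
       ; (inj₂ a₁ , inj₁ e₂ , _) → inj₂ (inj₂ (a₁ , e₂))
       ; (inj₁ _  , inj₁ _  , ()) })

directLabel : Bool → ℕ × ℕ
directLabel true  = 1 , 0
directLabel false = 0 , 0

directLabel-meets : MeetPattern directLabel directLabel _∧_
directLabel-meets true  true  = mk⇔ (λ _ → tt) (λ _ → 0 , (0 , refl) , (0 , refl))
directLabel-meets true  false = mk⇔ ((λ ()) ∘ APMeet-const⇒≡) λ ()
directLabel-meets false _     = mk⇔ ¬APMeet-zeroˡ λ ()

cartesianLabel₁ cartesianLabel₂ : Bool → ℕ × ℕ
cartesianLabel₁ true  = 1 , 0
cartesianLabel₁ false = 2 , 0
cartesianLabel₂ true  = 2 , 0
cartesianLabel₂ false = 1 , 0

cartesianLabel-meets : MeetPattern cartesianLabel₁ cartesianLabel₂ _xor_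
cartesianLabel-meets true  true  = mk⇔ ((λ ()) ∘ APMeet-const⇒≡) λ ()
cartesianLabel-meets true  false = mk⇔ (λ _ → tt) (λ _ → 0 , (0 , refl) , (0 , refl))
cartesianLabel-meets false true  = mk⇔ (λ _ → tt) (λ _ → 1 , (0 , refl) , (0 , refl))
cartesianLabel-meets false false = mk⇔ ((λ ()) ∘ APMeet-const⇒≡) λ ()

normalLabel₁ normalLabel₂ : Bool → ℕ × ℕ
normalLabel₁ true  = 1 , 1
normalLabel₁ false = 1 , 0
normalLabel₂ true  = 1 , 1
normalLabel₂ false = 2 , 0

normalLabel-meets : MeetPattern normalLabel₁ normalLabel₂ _∨_
normalLabel-meets true  true  = mk⇔ (λ _ → tt) (λ _ → 0 , (0 , refl) , (0 , refl))
normalLabel-meets true  false = mk⇔ (λ _ → tt) (λ _ → 1 , (1 , refl) , (0 , refl))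
normalLabel-meets false true  = mk⇔ (λ _ → tt) (λ _ → 0 , (0 , refl) , (0 , refl))
normalLabel-meets false false = mk⇔ ((λ ()) ∘ APMeet-const⇒≡) λ ()

mainTheorem2 : (Γ₁ Γ₂ : Graph) →
    IsGeneralizedProduct Γ₁ Γ₂ (DirectAdj Γ₁ Γ₂)
    × IsGeneralizedProduct Γ₁ Γ₂ (CartesianAdj Γ₁ Γ₂)
    × IsGeneralizedProduct Γ₁ Γ₂ (NormalAdj Γ₁ Γ₂)
mainTheorem2 Γ₁ Γ₂ =
  isGeneralizedProduct Γ₁ Γ₂ directLabel-meets    refl (direct⇔∧ Γ₁ Γ₂) ,
  isGeneralizedProduct Γ₁ Γ₂ cartesianLabel-meets refl (cartesian⇔xor Γ₁ Γ₂) ,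
  isGeneralizedProduct Γ₁ Γ₂ normalLabel-meets    refl (normal⇔∨ Γ₁ Γ₂)
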